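{- (Soundness of the ability fragment of CCSR.) Every formula derivable in the axiomatic system $\mathsf{CCSR}_{AB}$ described in the context is valid.
   Context: Fix a nonempty finite set $Ag$ of agents and a countable set $AP$ of atomic propositions. A coalition is a subset of $Ag$. For a nonempty set $Ac$ of actions and a coalition $A$, a joint action of $A$ is a function $\sigma_A:A\to Ac$; $JA_A$ is the set of these (so $JA_\emptyset=\{\emptyset\}$) and $JA=\bigcup_{A\subseteq Ag}JA_A$. A concurrent game model is $M=(St,Ac,av,out,L)$ where $St$ is a nonempty set of states; $Ac$ a nonempty set of actions; $av$ assigns to each $s\in St$ and coalition $A$ a nonempty set $av(s,A)\subseteq JA_A$ such that for $A\neq\emptyset$, $av(s,A)=\{\bigcup_{a\in A}\sigma_a\mid \sigma_a\in av(s,\{a\})\text{ for each }a\in A\}$ (and $av(s,\emptyset)=\{\emptyset\}$); $out$ assigns to each $s\in St$ and $\sigma\in JA_A$ a set of states with $out(s,\sigma)=\emptyset$ if $\sigma\notin av(s,A)$, $out(s,\sigma)$ a singleton if $A=Ag$ and $\sigma\in av(s,Ag)$, and $out(s,\sigma)=\bigcup\{out(s,\sigma')\mid\sigma'\in av(s,Ag),\ \sigma\subseteq\sigma'\}$ if $A\neq Ag$ and $\sigma\in av(s,A)$; $L:St\to\mathcal P(AP)$. For joint actions $\sigma_A,\sigma_B$ of $A,B$ let $\sigma_A\uplus\sigma_B=\sigma_A\cup\{(b,\beta)\in\sigma_B\mid b\in B\setminus A\}$. $\Phi_{\mathsf{CCSR}}$: $\phi::=p\mid\top\mid\neg\phi\mid(\phi\wedge\phi)\mid\mathsf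 C(A,\phi;B,\phi)$; $M,s\models\mathsf C(A,\phi;B,\psi)$ iff there is $\sigma_A\in av(s,A)$ with $M,t\models\phi$ for all $t\in out(s,\sigma_A)$ and there is $\sigma_B\in av(s,B)$ with $M,t\models\psi$ for all $t\in out(s,\sigma_A\uplus\sigma_B)$; booleans standard. Valid = true at every pointed concurrent game model. $\Phi_{\mathsf{CCSR}_{AB}}$: $\phi::=\top\mid\bot\mid p\mid\neg p\mid(\phi\wedge\phi)\mid(\phi\vee\phi)\mid\mathsf C(A,\phi;B,\phi)$. System $\mathsf{CCSR}_{AB}$: axioms are the propositional tautologies in $\Phi_{\mathsf{CCSR}_{AB}}$; rules: R1: from $\phi_1,\dots,\phi_n$ infer $\psi$, where $(\phi_1\wedge\dots\wedge\phi_n)\to\psi$ is a propositional tautology; R2: from $\phi$ infer $\mathsf C(A,\phi;\emptyset,\top)$; R3: from $\mathsf C(A,\phi_1\vee\phi_2;\emptyset,\top)\vee\chi$ infer $\mathsf C(A,\phi_1;\emptyset,\top)\vee\mathsf C(Ag,\phi_2;\emptyset,\top)\vee\chi$; R4: from $\mathsf C(A,\phi\wedge\psi;\emptyset,\top)\vee\chi$ infer $\mathsf C(A,\phi;B,\psi)\vee\chi$; R5: from $(\mathsf C(A\cup B,\phi\wedge\psi;\emptyset,\top)\wedge\mathsf C(\emptyset,\phi;\emptyset,\top))\vee\chi$ infer $\mathsf C(A,\phi;B,\psi)\vee\chi$. -}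

module Defs where

open import Level using (0ℓ)
open import Data.Nat using (ℕ; suc)
open import Data.Fin using (Fin)
open import Data.Bool using (Bool; true; false; if_then_else_; _∧_; _∨_; not)
open import Data.Maybe using (Maybe; just; nothing; is-just)
open import Data.Vec using (Vec; lookup; map; tabulate; replicate; zipWith)
open import Data.Fin.Subset using (Subset; ⁅_⁆; Nonempty; _∪_)
  renaming (⊤ to Full; ⊥ to Empty; _∈_ to _∈ₛ_)
open import Data.List using (List; []; _∷_)
open import Data.List.Relation.Unary.All using (All)
open import Data.Product using (Σ; ∃; _×_; _,_)
open import Data.Unit using (⊤)
open import Relation.Nullary using (¬_)
open import Relation.Binary.PropositionalEquality using (_≡_; _≢_)
open import Function.Definitions using (Injective)

Countable : Set → Set
Countable X = Σ (X → ℕ) (λ f → Injective _≡_ _≡_ f)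

_⇔'_ : Set → Set → Set
P ⇔' Q = (P → Q) × (Q → P)
infix 3 _⇔'_

module CCSR (n : ℕ) (AP : Set) where

  Coalition : Set
  Coalition = Subset (suc n)

  Ag : Coalition
  Ag = Full

  ∅ : Coalition
  ∅ = Empty

  data Form : Set where
    atom : AP → Form
    tt   : Form
    neg  : Form → Form
    _∧ᶠ_ : Form → Form → Form
    C    : Coalition → Form → Coalition → Form → Form

  data FormAB : Set where
    ⊤ᵃ   : FormAB
    ⊥ᵃ   : FormAB
    pos  : AP → FormAB
    negp : AP → FormAB
    _∧ᵃ_ : FormAB → FormAB → FormAB
    _∨ᵃ_ : FormAB → FormAB → FormAB
    Cᵃ   : Coalition → FormAB → Coalition → FormAB → FormAB

  infixr 6 _∧ᵃ_
  infixr 5 _∨ᵃ_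

  embed : FormAB → Form
  embed ⊤ᵃ = tt
  embed ⊥ᵃ = neg tt
  embed (pos p) = atom p
  embed (negp p) = neg (atom p)
  embed (φ ∧ᵃ ψ) = embed φ ∧ᶠ embed ψ
  embed (φ ∨ᵃ ψ) = neg (neg (embed φ) ∧ᶠ neg (embed ψ))
  embed (Cᵃ A φ B ψ) = C A (embed φ) B (embed ψ)

  -- Propositional tautologies: atoms p and the C-formulas are treated
  -- as propositional variables.

  record PValuation : Set where
    field
      vatom : AP → Bool
      vC    : Coalition → FormAB → Coalition → FormAB → Bool

  peval : PValuation → FormAB → Bool
  peval v ⊤ᵃ = true
  peval v ⊥ᵃ = false
  peval v (pos p) = PValuation.vatom v p
  peval v (negp p) = not (PValuation.vatom v p)
  peval v (φ ∧ᵃ ψ) = peval v φ ∧ peval v ψ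
  peval v (φ ∨ᵃ ψ) = peval v φ ∨ peval v ψ
  peval v (Cᵃ A φ B ψ) = PValuation.vC v A φ B ψ

  TautCons : List FormAB → FormAB → Set
  TautCons Γ ψ = (v : PValuation) → All (λ φ → peval v φ ≡ true) Γ → peval v ψ ≡ true

  Tautology : FormAB → Set
  Tautology φ = (v : PValuation) → peval v φ ≡ true

  data Derivable : FormAB → Set where
    ax : ∀ {φ} → Tautology φ → Derivable φ
    R1 : ∀ {Γ ψ} → All Derivable Γ → TautCons Γ ψ → Derivable ψ
    R2 : ∀ {A φ} → Derivable φ → Derivable (Cᵃ A φ ∅ ⊤ᵃ)
    R3 : ∀ {A φ₁ φ₂ χ} → Derivable (Cᵃ A (φ₁ ∨ᵃ φ₂) ∅ ⊤ᵃ ∨ᵃ χ)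
       → Derivable (Cᵃ A φ₁ ∅ ⊤ᵃ ∨ᵃ Cᵃ Ag φ₂ ∅ ⊤ᵃ ∨ᵃ χ)
    R4 : ∀ {A B φ ψ χ} → Derivable (Cᵃ A (φ ∧ᵃ ψ) ∅ ⊤ᵃ ∨ᵃ χ)
       → Derivable (Cᵃ A φ B ψ ∨ᵃ χ)
    R5 : ∀ {A B φ ψ χ}
       → Derivable ((Cᵃ (A ∪ B) (φ ∧ᵃ ψ) ∅ ⊤ᵃ ∧ᵃ Cᵃ ∅ φ ∅ ⊤ᵃ) ∨ᵃ χ)
       → Derivable (Cᵃ A φ B ψ ∨ᵃ χ)

  -- A joint action is a vector over Ag of optional actions; its domain
  -- (the coalition it is a joint action of) is the set of agents with
  -- an action.  JA_A = { σ | dom σ ≡ A }.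

  module JointActions (Ac : Set) where
    JA : Set
    JA = Vec (Maybe Ac) (suc n)

    dom : JA → Coalition
    dom σ = map is-just σ

    -- σ ⊆ σ' as sets of pairs (agent, action)
    _⊆J_ : JA → JA → Set
    σ ⊆J σ' = ∀ i x → lookup σ i ≡ just x → lookup σ' i ≡ just x

    ∅J : JA
    ∅J = replicate (suc n) nothing

    -- ⋃_{a ∈ A} σ_a  where each σ_a is a joint action of {a}
    bigUnion : Coalition → (Fin (suc n) → JA) → JA
    bigUnion A g = tabulate (λ i → if lookup A i then lookup (g i) i else nothing)

    -- σ_A ⊎ σ_B = σ_A ∪ {(b,β) ∈ σ_B | b ∉ dom σ_A}
    _⊎J_ : JA → JA → JA
    σ ⊎J τ = zipWith pick σ τ
      where
        pick : Maybe Ac → Maybe Ac → Maybe Ac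
        pick (just x) _ = just x
        pick nothing y = y

  record Model : Set₁ where
    field
      St  : Set
      Ac  : Set
    open JointActions Ac public
    field
      ac₀ : Ac
      av  : St → Coalition → JA → Set
      out : St → JA → St → Set
      L   : St → AP → Set
      av-JA       : ∀ s A σ → av s A σ → dom σ ≡ A
      av-nonempty : ∀ s A → ∃ (av s A)
      av-∅        : ∀ s σ → av s ∅ σ ⇔' σ ≡ ∅J
      av-union    : ∀ s A → Nonempty A → ∀ σ →
                    av s A σ ⇔' Σ (Fin (suc n) → JA) (λ g →
                      (∀ i → i ∈ₛ A → av s ⁅ i ⁆ (g i)) × σ ≡ bigUnion A g)
      out-unavail : ∀ s σ t → ¬ av s (dom σ) σ → ¬ out s σ t
      out-full    : ∀ s σ → dom σ ≡ Ag → av s Ag σ →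
                    ∃ λ t → ∀ t' → out s σ t' ⇔' t' ≡ t
      out-partial : ∀ s σ → dom σ ≢ Ag → av s (dom σ) σ → ∀ t →
                    out s σ t ⇔' Σ JA (λ σ' → av s Ag σ' × σ ⊆J σ' × out s σ' t)

  module _ (M : Model) where
    open Model M

    Sat : St → Form → Set
    Sat s (atom p) = L s p
    Sat s (tt) = ⊤
    Sat s (neg φ) = ¬ (Sat s (φ))
    Sat s ((φ ∧ᶠ ψ)) = (Sat s (φ)) × (Sat s (ψ))
    Sat s (C A φ B ψ) =
      Σ JA λ σA → av s A σA × (∀ t → out s σA t → Sat t (φ)) ×
        Σ JA λ σB → av s B σB × (∀ t → out s (σA ⊎J σB) t → Sat t (ψ))

  Valid : Form → Set₁
  Valid φ = (M : Model) (s : Model.St M) → Sat M s φ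

{-# OPTIONS --safe #-}
-- Every pointed model induces, by excluded
-- middle, a propositional valuation that reflects satisfaction of all AB-formulas, so axioms and
-- R1 are sound.  Rules R2–R5 rest on three facts about outcome sets: extending an available joint
-- action shrinks its outcome set, the outcome set of a full joint action is a singleton, and
-- available joint actions decompose agent-wise.
module Submission where

open import Defs
open import Level using (0ℓ)
open import Data.Nat using (ℕ; suc)
open import Axiom.ExcludedMiddle using (ExcludedMiddle)
open import Data.Bool using (true; false; if_then_else_; _∨_)
open import Data.Bool.Properties using (_≟_)
open import Data.Fin using (Fin; zero)
open import Data.Fin.Subset using (⁅_⁆; Empty; _∪_) renaming (_∈_ to _∈ₛ_)
open import Data.Fin.Subset.Properties using (Empty-unique; nonempty?; x∈p∪q⁺)
open import Data.Maybe using (Maybe; just; nothing; is-just; _<∣>_)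
open import Data.Vec using (lookup; replicate)
open import Data.Vec.Properties using (lookup-map; lookup-replicate; lookup-zipWith; lookup∘tabulate; ≡-dec)
open import Data.Vec.Relation.Binary.Pointwise.Extensional using (ext; Pointwise-≡⇒≡)
open import Data.List.Relation.Unary.All using (All; []; _∷_)
open import Data.Product using (Σ; ∃; _×_; _,_; proj₁; proj₂; uncurry)
open import Data.Sum using (_⊎_; inj₁; inj₂; [_,_]′)
open import Data.Unit using (tt)
open import Function using (_∘_; id; case_of_)
open import Relation.Nullary using (¬_; yes; no; does; proof; contradiction)
open import Relation.Nullary.Decidable using (decidable-stable)
open import Relation.Nullary.Reflects using (Reflects; ofʸ; ofⁿ; ¬-reflects; _×-reflects_; invert; det)
open import Relation.Unary using (Pred; _⊆′_; _∩_; ∁; U)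
open import Relation.Binary.PropositionalEquality using (_≡_; refl; sym; trans; cong; cong₂; subst; module ≡-Reasoning)

_∨ᶜ_ : Set → Set → Set
X ∨ᶜ Y = ¬ (¬ X × ¬ Y)

∨ᶜ-reflects : ∀ {X Y a b} → Reflects X a → Reflects Y b → Reflects (X ∨ᶜ Y) (a ∨ b)
∨ᶜ-reflects (ofʸ x)  _        = ofʸ λ (¬x , _) → ¬x x
∨ᶜ-reflects (ofⁿ ¬x) (ofʸ y)  = ofʸ λ (_ , ¬y) → ¬y y
∨ᶜ-reflects (ofⁿ ¬x) (ofⁿ ¬y) = ofⁿ λ ¬[¬x×¬y] → ¬[¬x×¬y] (¬x , ¬y)

∨ᶜ-mapˡ : ∀ {X X′ Y : Set} → (X → X′) → X ∨ᶜ Y → X′ ∨ᶜ Y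
∨ᶜ-mapˡ f x∨y (¬x′ , ¬y) = x∨y (¬x′ ∘ f , ¬y)

module JointActionProperties (n : ℕ) (AP Ac : Set) where
  open CCSR n AP
  open JointActions Ac

  -- `_⊎J_` zips with a combinator local to its definition; a one-point lookup exposes it.
  lookup-⊎J : ∀ σ τ i → lookup (σ ⊎J τ) i ≡ lookup σ i <∣> lookup τ i
  lookup-⊎J σ τ i = trans (lookup-zipWith _ i σ τ) (pick≡<∣> (lookup σ i) (lookup τ i))
    where
    pick≡<∣> : ∀ (m m′ : Maybe Ac) →
               lookup (replicate (suc n) m ⊎J replicate (suc n) m′) zero ≡ m <∣> m′
    pick≡<∣> (just x) m′ = refl
    pick≡<∣> nothing  m′ = refl

  lookup-bigUnion : ∀ A g i → lookup (bigUnion A g) i ≡ (if lookup A i then lookup (g i) i else nothing)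
  lookup-bigUnion A g i = lookup∘tabulate (λ j → if lookup A j then lookup (g j) j else nothing) i

  ⊆J-trans : ∀ {σ τ υ} → σ ⊆J τ → τ ⊆J υ → σ ⊆J υ
  ⊆J-trans σ⊆τ τ⊆υ i x = τ⊆υ i x ∘ σ⊆τ i x

  ⊆J-⊎J : ∀ σ τ → σ ⊆J (σ ⊎J τ)
  ⊆J-⊎J σ τ i x σi≡x = trans (lookup-⊎J σ τ i) (cong (_<∣> lookup τ i) σi≡x)

  ∅J-⊆J : ∀ σ → ∅J ⊆J σ
  ∅J-⊆J σ i x ∅Ji≡x = case trans (sym (lookup-replicate i nothing)) ∅Ji≡x of λ ()

  ⊆J-maximal : ∀ {σ τ} → dom σ ≡ Ag → σ ⊆J τ → σ ≡ τ
  ⊆J-maximal {σ} {τ} σ-full σ⊆τ = Pointwise-≡⇒≡ (ext pointwise)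
    where
    pointwise : ∀ i → lookup σ i ≡ lookup τ i
    pointwise i with lookup σ i in σi≡
    ... | just x  = sym (σ⊆τ i x σi≡)
    ... | nothing = case trans (trans (cong is-just (sym σi≡)) (sym (lookup-map i is-just σ)))
                               (trans (cong (λ X → lookup X i) σ-full) (lookup-replicate i true))
                    of λ ()

  bigUnion-Empty : ∀ {A} g → Empty A → bigUnion A g ≡ ∅J
  bigUnion-Empty {A} g A-empty = Pointwise-≡⇒≡ (ext λ i → begin
    lookup (bigUnion A g) i
      ≡⟨ lookup-bigUnion A g i ⟩
    (if lookup A i then lookup (g i) i else nothing)
      ≡⟨ cong (λ b → if b then lookup (g i) i else nothing) (A-false i) ⟩
    nothing
      ≡⟨ sym (lookup-replicate i nothing) ⟩
    lookup ∅J i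
      ∎)
    where
    open ≡-Reasoning
    A-false : ∀ i → lookup A i ≡ false
    A-false i = trans (cong (λ X → lookup X i) (Empty-unique A-empty)) (lookup-replicate i false)

  bigUnion-∪ : ∀ A B g → bigUnion (A ∪ B) g ≡ bigUnion A g ⊎J bigUnion B g
  bigUnion-∪ A B g = Pointwise-≡⇒≡ (ext λ i → let m = lookup (g i) i in begin
    lookup (bigUnion (A ∪ B) g) i
      ≡⟨ lookup-bigUnion (A ∪ B) g i ⟩
    (if lookup (A ∪ B) i then m else nothing)
      ≡⟨ cong (λ b → if b then m else nothing) (lookup-zipWith _∨_ i A B) ⟩
    (if lookup A i ∨ lookup B i then m else nothing)
      ≡⟨ if-∨ (lookup A i) (lookup B i) m ⟩
    (if lookup A i then m else nothing) <∣> (if lookup B i then m else nothing)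
      ≡⟨ sym (cong₂ _<∣>_ (lookup-bigUnion A g i) (lookup-bigUnion B g i)) ⟩
    lookup (bigUnion A g) i <∣> lookup (bigUnion B g) i
      ≡⟨ sym (lookup-⊎J (bigUnion A g) (bigUnion B g) i) ⟩
    lookup (bigUnion A g ⊎J bigUnion B g) i
      ∎)
    where
    open ≡-Reasoning
    if-∨ : ∀ a b (m : Maybe Ac) →
           (if a ∨ b then m else nothing) ≡ (if a then m else nothing) <∣> (if b then m else nothing)
    if-∨ true  b     (just x) = refl
    if-∨ true  true  nothing  = refl
    if-∨ true  false nothing  = refl
    if-∨ false b     m        = refl

module ModelProperties (n : ℕ) (AP : Set) (lem : ExcludedMiddle 0ℓ) (M : CCSR.Model n AP) where
  open CCSR n AP
  open Model M
  open JointActionProperties n AP Ac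

  -- `Sat M s (C A φ B ψ)` unfolds to `Able s A (λ t → Sat M t φ) B (λ t → Sat M t ψ)`.
  Able : St → Coalition → Pred St 0ℓ → Coalition → Pred St 0ℓ → Set
  Able s A P B Q = Σ JA λ σA → av s A σA × out s σA ⊆′ P ×
                   Σ JA λ σB → av s B σB × out s (σA ⊎J σB) ⊆′ Q

  stable : ∀ {X : Set} → ¬ ¬ X → X
  stable = decidable-stable lem

  av-dom : ∀ {s A σ} → av s A σ → av s (dom σ) σ
  av-dom {s} {A} {σ} a = subst (λ X → av s X σ) (sym (av-JA s A σ a)) a

  av-bigUnion⁺ : ∀ {s} A g → (∀ i → i ∈ₛ A → av s ⁅ i ⁆ (g i)) → av s A (bigUnion A g)
  av-bigUnion⁺ {s} A g av-g with nonempty? A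
  ... | yes A-nonempty = proj₂ (av-union s A A-nonempty _) (g , av-g , refl)
  ... | no A-empty     = subst (λ X → av s X (bigUnion A g)) (sym (Empty-unique A-empty))
                               (proj₂ (av-∅ s _) (bigUnion-Empty g A-empty))

  av-bigUnion⁻ : ∀ {s A σ} → av s A σ →
                 Σ (Fin (suc n) → JA) λ g → (∀ i → i ∈ₛ A → av s ⁅ i ⁆ (g i)) × σ ≡ bigUnion A g
  av-bigUnion⁻ {s} {A} {σ} a with nonempty? A
  ... | yes A-nonempty = proj₁ (av-union s A A-nonempty σ) a
  ... | no A-empty     = (λ _ → ∅J) , (λ i i∈A → contradiction (i , i∈A) A-empty) ,
                         trans σ≡∅J (sym (bigUnion-Empty (λ _ → ∅J) A-empty))
    where
    σ≡∅J : σ ≡ ∅J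
    σ≡∅J = proj₁ (av-∅ s σ) (subst (λ X → av s X σ) (Empty-unique A-empty) a)

  out-full-extension : ∀ {s A τ t} → av s A τ → out s τ t →
                       Σ JA λ σ → av s Ag σ × τ ⊆J σ × out s σ t
  out-full-extension {s} {A} {τ} {t} a o with ≡-dec _≟_ (dom τ) Ag
  ... | yes τ-full    = τ , subst (λ X → av s X τ) τ-full (av-dom a) , (λ _ _ → id) , o
  ... | no τ-partial  = proj₁ (out-partial s τ τ-partial (av-dom a) t) o

  out-full-unique : ∀ {s σ t t′} → av s Ag σ → out s σ t → out s σ t′ → t′ ≡ t
  out-full-unique {s} {σ} {t} {t′} a o o′ with out-full s σ (av-JA s Ag σ a) a
  ... | _ , ≡t₀ = trans (proj₁ (≡t₀ t′) o′) (sym (proj₁ (≡t₀ t) o))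

  out-antitone : ∀ {s A σ τ} → av s A σ → σ ⊆J τ → out s τ ⊆′ out s σ
  out-antitone {s} {A} {σ} {τ} aσ σ⊆τ t o with lem {av s (dom τ) τ}
  ... | no τ-unavailable = contradiction o (out-unavail s τ t τ-unavailable)
  ... | yes aτ with out-full-extension aτ o
  ...   | σ′ , aσ′ , τ⊆σ′ , o′ with ≡-dec _≟_ (dom σ) Ag
  ...     | yes σ-full    = subst (λ υ → out s υ t)
                                  (sym (⊆J-maximal σ-full (⊆J-trans {σ} {τ} {σ′} σ⊆τ τ⊆σ′))) o′
  ...     | no σ-partial  = proj₂ (out-partial s σ σ-partial (av-dom aσ) t)
                                  (σ′ , aσ′ , ⊆J-trans {σ} {τ} {σ′} σ⊆τ τ⊆σ′ , o′)

  Able-∅-intro : ∀ {s A σ P} → av s A σ → out s σ ⊆′ P → Able s A P ∅ U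
  Able-∅-intro {s} {σ = σ} a σ⊆P =
    σ , a , σ⊆P , proj₁ (av-nonempty s ∅) , proj₂ (av-nonempty s ∅) , λ _ _ → tt

  -- If σ misses P at some outcome t, a full extension of σ reaches t and only t, where Q holds.
  Able-∨-split : ∀ {s A P Q} → Able s A (∁ (∁ P ∩ ∁ Q)) ∅ U → Able s A P ∅ U ⊎ Able s Ag Q ∅ U
  Able-∨-split {s} {P = P} {Q} (σ , a , σ⊆P∨Q , _) with lem {∃ λ t → out s σ t × ¬ P t}
  ... | no ∄¬P = inj₁ (Able-∅-intro a λ t o → stable λ ¬Pt → ∄¬P (t , o , ¬Pt))
  ... | yes (t , o , ¬Pt) with out-full-extension a o
  ...   | σ′ , a′ , _ , o′ =
    inj₂ (Able-∅-intro a′ λ t′ o″ → subst Q (sym (out-full-unique a′ o′ o″)) Qt)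
    where
    Qt : Q t
    Qt = stable λ ¬Qt → σ⊆P∨Q t o (¬Pt , ¬Qt)

  Able-∩⇒Able : ∀ {s A P Q} B → Able s A (P ∩ Q) ∅ U → Able s A P B Q
  Able-∩⇒Able {s} B (σA , a , σA⊆P∩Q , _) with av-nonempty s B
  ... | σB , aB = σA , a , (λ t → proj₁ ∘ σA⊆P∩Q t) , σB , aB ,
                  λ t o → proj₂ (σA⊆P∩Q t (out-antitone a (⊆J-⊎J σA σB) t o))

  -- Split the agent-wise decomposition of the (A ∪ B)-action between A and B: the A-part extends
  -- the empty action, so it ensures P, and together with the B-part it recomposes the (A ∪ B)-action.
  Able-∪⇒Able : ∀ {s P Q} A B → Able s (A ∪ B) (P ∩ Q) ∅ U → Able s ∅ P ∅ U → Able s A P B Q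
  Able-∪⇒Able {s} A B (τ , aτ , τ⊆P∩Q , _) (ε , aε , ε⊆P , _) with av-bigUnion⁻ aτ
  ... | g , av-g , τ≡ = σA , av-bigUnion⁺ A g (λ i → av-g i ∘ x∈p∪q⁺ ∘ inj₁) , σA⊆P ,
                        σB , av-bigUnion⁺ B g (λ i → av-g i ∘ x∈p∪q⁺ {p = A} ∘ inj₂) , σA⊎σB⊆Q
    where
    σA = bigUnion A g
    σB = bigUnion B g
    ε⊆σA : ε ⊆J σA
    ε⊆σA = subst (_⊆J σA) (sym (proj₁ (av-∅ s ε) aε)) (∅J-⊆J σA)
    σA⊆P : out s σA ⊆′ _
    σA⊆P t o = ε⊆P t (out-antitone aε ε⊆σA t o)
    τ≡σA⊎σB : τ ≡ σA ⊎J σB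
    τ≡σA⊎σB = trans τ≡ (bigUnion-∪ A B g)
    σA⊎σB⊆Q : out s (σA ⊎J σB) ⊆′ _
    σA⊎σB⊆Q t o = proj₂ (τ⊆P∩Q t (subst (λ υ → out s υ t) (sym τ≡σA⊎σB) o))

module Soundness (n : ℕ) (AP : Set) (lem : ExcludedMiddle 0ℓ) where
  open CCSR n AP
  open ModelProperties n AP lem

  valuation : (M : Model) → Model.St M → PValuation
  valuation M s = record
    { vatom = λ p → does (lem {Model.L M s p})
    ; vC    = λ A φ B ψ → does (lem {Sat M s (C A (embed φ) B (embed ψ))})
    }

  peval-reflects : ∀ M s φ → Reflects (Sat M s (embed φ)) (peval (valuation M s) φ)
  peval-reflects M s ⊤ᵃ           = ofʸ tt
  peval-reflects M s ⊥ᵃ           = ofⁿ λ ¬⊤ → ¬⊤ tt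
  peval-reflects M s (pos p)      = proof lem
  peval-reflects M s (negp p)     = ¬-reflects (proof lem)
  peval-reflects M s (φ ∧ᵃ ψ)     = peval-reflects M s φ ×-reflects peval-reflects M s ψ
  peval-reflects M s (φ ∨ᵃ ψ)     = ∨ᶜ-reflects (peval-reflects M s φ) (peval-reflects M s ψ)
  peval-reflects M s (Cᵃ A φ B ψ) = proof lem

  peval-true⇒Sat : ∀ M s φ → peval (valuation M s) φ ≡ true → Sat M s (embed φ)
  peval-true⇒Sat M s φ φ-true = invert (subst (Reflects _) φ-true (peval-reflects M s φ))

  Sat⇒peval-true : ∀ M s φ → Sat M s (embed φ) → peval (valuation M s) φ ≡ true
  Sat⇒peval-true M s φ φ-holds = det (peval-reflects M s φ) (ofʸ φ-holds)

  sound : ∀ {φ} → Derivable φ → Valid (embed φ)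
  sound-All : ∀ {Γ} → All Derivable Γ → ∀ M s → All (λ φ → peval (valuation M s) φ ≡ true) Γ

  sound {φ} (ax taut)    M s = peval-true⇒Sat M s φ (taut (valuation M s))
  sound {φ} (R1 ds cons) M s = peval-true⇒Sat M s φ (cons (valuation M s) (sound-All ds M s))
  sound (R2 d) M s = Able-∅-intro M (proj₂ (Model.av-nonempty M s _)) λ t _ → sound d M t
  sound (R3 d) M s (¬C₁ , ¬¬[¬C₂×¬χ]) =
    ¬¬[¬C₂×¬χ] λ (¬C₂ , ¬χ) → sound d M s ([ ¬C₁ , ¬C₂ ]′ ∘ Able-∨-split M , ¬χ)
  sound (R4 {B = B} d) M s = ∨ᶜ-mapˡ (Able-∩⇒Able M B) (sound d M s)
  sound (R5 {A} {B} d) M s = ∨ᶜ-mapˡ (uncurry (Able-∪⇒Able M A B)) (sound d M s)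

  sound-All []       M s = []
  sound-All (_∷_ {x = φ} d ds) M s = Sat⇒peval-true M s φ (sound d M s) ∷ sound-All ds M s

mainTheorem4 : (n : ℕ) (AP : Set) → Countable AP → ExcludedMiddle 0ℓ →
    (φ : CCSR.FormAB n AP) → CCSR.Derivable n AP φ → CCSR.Valid n AP (CCSR.embed n AP φ)
mainTheorem4 n AP _ lem φ = Soundness.sound n AP lem
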